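{- In intensional Martin-Löf type theory with function extensionality, there is a logical equivalence $$\Big(\prod_{X:\mathcal U}\neg\neg X\to\mathrm{Pop}(X)\Big)\;\Leftrightarrow\;\prod_{P:\mathcal U}\mathrm{isProp}(P)\to P+\neg P.$$
   Context: Intensional Martin-Löf type theory with a universe $\mathcal U$ (and a larger universe as needed), $\Sigma$, $\Pi$, $+$, empty type $\mathbf 0$ and identity types (J only; no UIP/K). $\neg A:\equiv A\to\mathbf 0$. $\mathrm{isProp}(A):\equiv\prod_{a,b:A}a=b$. $\mathrm{Pop}(X):\equiv\prod_{f:X\to X}\Big(\big(\prod_{x,y:X}f(x)=f(y)\big)\to\sum_{x:X}x=f(x)\Big)$. Function extensionality: pointwise equal dependent functions are equal. $\Leftrightarrow$ means functions in both directions. -}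

module Defs where

open import Level using (0ℓ)
open import Data.Empty using (⊥)
open import Data.Product using (Σ; Σ-syntax)
open import Data.Sum using (_⊎_)
open import Relation.Binary.PropositionalEquality using (_≡_)
open import Axiom.Extensionality.Propositional using (Extensionality)

¬' : Set → Set
¬' A = A → ⊥

isProp : Set → Set
isProp A = (a b : A) → a ≡ b

Pop : Set → Set
Pop X = (f : X → X) → ((x y : X) → f x ≡ f y) → Σ[ x ∈ X ] x ≡ f x

FunExt : Set₁
FunExt = Extensionality 0ℓ 0ℓ

-- The fixed points of a weakly constant endomap form a proposition (Kraus, Escardó,
-- Coquand, Altenkirch). Hence, under excluded middle for propositions, Fix f is decided;
-- it cannot be empty when X is not empty, since f x is a fixed point for every x.
-- Conversely, P ⊎ ¬ P is a double-negated proposition (¬ P is one by function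
-- extensionality), and Pop applied to the identity of a proposition yields an element.
module Submission where

open import Defs
open import Data.Empty using (⊥-elim)
open import Data.Product using (_×_; _,_; Σ-syntax; proj₁)
open import Data.Product.Properties using (Σ-≡,≡→≡)
open import Data.Sum using (_⊎_; inj₁; inj₂)
open import Function using (id)
open import Relation.Binary.PropositionalEquality
  using (_≡_; refl; sym; trans; cong; subst; module ≡-Reasoning)
open import Relation.Binary.PropositionalEquality.Properties using (trans-reflʳ; trans-symˡ)

LEM : Set₁
LEM = (P : Set) → isProp P → P ⊎ ¬' P

WeaklyConstant : {A B : Set} → (A → B) → Set
WeaklyConstant {A} f = (x y : A) → f x ≡ f y

Fix : {X : Set} → (X → X) → Set
Fix {X} f = Σ[ x ∈ X ] x ≡ f x

¬-isProp : FunExt → {A : Set} → isProp (¬' A)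
¬-isProp fe u v = fe (λ a → ⊥-elim (u a))

⊎-isProp : {P Q : Set} → isProp P → isProp Q → (P → ¬' Q) → isProp (P ⊎ Q)
⊎-isProp pP pQ disjoint (inj₁ a) (inj₁ b) = cong inj₁ (pP a b)
⊎-isProp pP pQ disjoint (inj₁ a) (inj₂ v) = ⊥-elim (disjoint a v)
⊎-isProp pP pQ disjoint (inj₂ u) (inj₁ b) = ⊥-elim (disjoint b u)
⊎-isProp pP pQ disjoint (inj₂ u) (inj₂ v) = cong inj₂ (pQ u v)

excluded-middle-isProp : FunExt → {P : Set} → isProp P → isProp (P ⊎ ¬' P)
excluded-middle-isProp fe pP = ⊎-isProp pP (¬-isProp fe) (λ a u → u a)

¬¬-excluded-middle : {P : Set} → ¬' (¬' (P ⊎ ¬' P))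
¬¬-excluded-middle k = k (inj₂ (λ a → k (inj₁ a)))

Pop-isProp-elim : {Y : Set} → isProp Y → Pop Y → Y
Pop-isProp-elim pY pop = proj₁ (pop id pY)

LEM⇒¬¬-elim : LEM → {P : Set} → isProp P → ¬' (¬' P) → P
LEM⇒¬¬-elim lem {P} pP nn with lem P pP
... | inj₁ p = p
... | inj₂ n = ⊥-elim (nn n)

subst-fixed-point : {X : Set} (f : X → X) {a b : X} (e : a ≡ b) (p : a ≡ f a) →
                    subst (λ z → z ≡ f z) e p ≡ trans (sym e) (trans p (cong f e))
subst-fixed-point f refl p = sym (trans-reflʳ p)

cong-weaklyConstant : {A B : Set} {f : A → B} (c : WeaklyConstant f) {x y : A} (e : x ≡ y) →
                      cong f e ≡ trans (sym (c x x)) (c x y)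
cong-weaklyConstant c {x} refl = sym (trans-symˡ (c x x))

trans-sym-trans-sym : {A : Set} {x y z : A} (u : x ≡ z) (q : y ≡ z) →
                      trans (sym (trans u (sym q))) u ≡ q
trans-sym-trans-sym refl refl = refl

Fix-isProp : {X : Set} {f : X → X} → WeaklyConstant f → isProp (Fix f)
Fix-isProp {f = f} c (x , p) (y , q) = Σ-≡,≡→≡ (e , p-transported)
  where
  u : x ≡ f y
  u = trans p (trans (sym (c x x)) (c x y))
  e : x ≡ y
  e = trans u (sym q)
  open ≡-Reasoning
  p-transported : subst (λ z → z ≡ f z) e p ≡ q
  p-transported = begin
    subst (λ z → z ≡ f z) e p           ≡⟨ subst-fixed-point f e p ⟩
    trans (sym e) (trans p (cong f e))  ≡⟨ cong (λ t → trans (sym e) (trans p t)) (cong-weaklyConstant c e) ⟩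
    trans (sym e) u                     ≡⟨ trans-sym-trans-sym u q ⟩
    q                                   ∎

point⇒Fix : {X : Set} {f : X → X} → WeaklyConstant f → X → Fix f
point⇒Fix {f = f} c x = f x , c x (f x)

theorem7p8 : FunExt → ((((X : Set) → ¬' (¬' X) → Pop X) → ((P : Set) → isProp P → P ⊎ ¬' P)) × (((P : Set) → isProp P → P ⊎ ¬' P) → ((X : Set) → ¬' (¬' X) → Pop X)))
theorem7p8 fe = pop⇒lem , lem⇒pop
  where
  pop⇒lem : ((X : Set) → ¬' (¬' X) → Pop X) → LEM
  pop⇒lem pop P pP = Pop-isProp-elim (excluded-middle-isProp fe pP) (pop (P ⊎ ¬' P) ¬¬-excluded-middle)

  lem⇒pop : LEM → (X : Set) → ¬' (¬' X) → Pop X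
  lem⇒pop lem X nn f c = LEM⇒¬¬-elim lem (Fix-isProp c) (λ noFix → nn (λ x → noFix (point⇒Fix c x)))
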